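{- Let $R$ be a finite commutative ring with identity, written as a direct sum of local rings $R = R_1\oplus\cdots\oplus R_n$, where $R_i$ has unique maximal ideal $M_i$, $m_i=|M_i|$ and $q_i=|R_i/M_i|$. Let $R^{**}$ be the set of exceptional units of $R$. Then $$|R^{**}| = \prod_{i=1}^n m_i(q_i-2).$$
   Context: A unit $u$ of a commutative ring $R$ with identity is called exceptional if $1-u$ is also a unit; $R^{**}$ denotes the set of exceptional units. Every finite commutative ring with identity is uniquely a direct sum of finite local rings. -}

module Defs where

open import Level using (0ℓ)
open import Algebra.Bundles using (CommutativeRing)
open import Data.Nat using (ℕ)
open import Data.Sum using (_⊎_)
open import Data.Unit using (⊤)
open import Relation.Binary.PropositionalEquality using (_≡_)
open import Data.Fin using (Fin; zero; suc)
open import Data.Product using (Σ; ∃; _×_; _,_)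
open import Relation.Nullary using (¬_)

Ring₀ : Set₁
Ring₀ = CommutativeRing 0ℓ 0ℓ

module _ (R : Ring₀) where
  open CommutativeRing R

  IsUnit : Carrier → Set
  IsUnit u = ∃ λ v → u * v ≈ 1#

  IsExceptionalUnit : Carrier → Set
  IsExceptionalUnit u = IsUnit u × IsUnit (1# - u)

  record IsIdeal (I : Carrier → Set) : Set where
    field
      resp  : ∀ {x y} → x ≈ y → I x → I y
      zero∈ : I 0#
      +-closed : ∀ {x y} → I x → I y → I (x + y)
      *-closed : ∀ r {x} → I x → I (r * x)

  record IsMaximalIdeal (M : Carrier → Set) : Set₁ where
    field
      isIdeal : IsIdeal M
      proper  : ¬ M 1#
      maximal : ∀ J → IsIdeal J → (∀ {x} → M x → J x) →
                (∀ {x} → J x → M x) ⊎ J 1#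

  record IsLocalWithMaximal (M : Carrier → Set) : Set₁ where
    field
      isMaximal : IsMaximalIdeal M
      unique    : ∀ J → IsMaximalIdeal J → (∀ {x} → J x → M x) × (∀ {x} → M x → J x)

  -- the subset P (closed under ≈) has exactly k elements:
  -- an ≈-injective enumeration Fin k → Carrier whose image is P up to ≈
  HasSize : (Carrier → Set) → ℕ → Set
  HasSize P k = Σ (Fin k → Carrier) λ f →
    (∀ i j → f i ≈ f j → i ≡ j) × (∀ i → P (f i)) × (∀ x → P x → ∃ λ i → x ≈ f i)

  -- the quotient ring R / M has exactly k elements:
  -- a list of k coset representatives, pairwise incongruent mod M, covering R
  QuotientHasSize : (Carrier → Set) → ℕ → Set
  QuotientHasSize M k = Σ (Fin k → Carrier) λ f →
    (∀ i j → M (f i - f j) → i ≡ j) × (∀ x → ∃ λ i → M (x - f i))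

  Finite : Set
  Finite = ∃ λ k → HasSize (λ _ → ⊤) k

-- a ring isomorphism R ≅ R₁ ⊕ ⋯ ⊕ Rₙ (componentwise operations, pointwise equality)
record IsDirectSumIso (R : Ring₀) (n : ℕ) (Rs : Fin n → Ring₀)
         (φ : CommutativeRing.Carrier R → (i : Fin n) → CommutativeRing.Carrier (Rs i)) : Set where
  module R = CommutativeRing R
  module S (i : Fin n) = CommutativeRing (Rs i)
  field
    cong    : ∀ {x y} → x R.≈ y → ∀ i → S._≈_ i (φ x i) (φ y i)
    +-hom   : ∀ x y i → S._≈_ i (φ (x R.+ y) i) (S._+_ i (φ x i) (φ y i))
    *-hom   : ∀ x y i → S._≈_ i (φ (x R.* y) i) (S._*_ i (φ x i) (φ y i))
    0-hom   : ∀ i → S._≈_ i (φ R.0# i) (S.0# i)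
    1-hom   : ∀ i → S._≈_ i (φ R.1# i) (S.1# i)
    -‿hom   : ∀ x i → S._≈_ i (φ (R.- x) i) (S.-_ i (φ x i))
    injective  : ∀ x y → (∀ i → S._≈_ i (φ x i) (φ y i)) → x R.≈ y
    surjective : ∀ (t : (i : Fin n) → CommutativeRing.Carrier (Rs i)) →
                 ∃ λ x → ∀ i → S._≈_ i (φ x i) (t i)

module Submission where

-- Maximality of an ideal, as formulated here, yields excluded
--    middle (the ideal {x | x ∈ M ∨ Q} decides Q).  With excluded middle, a proper
--    ideal of a finitely enumerated ring is enlarged one element at a time to a
--    maximal ideal.
-- 2. Local rings.  A non-unit u generates a proper ideal, which lies in a maximal
--    ideal, which must be M; so M is exactly the set of non-units and u is an
--    exceptional unit iff neither u nor 1 - u lies in M.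
-- 3. Counting in a local ring.  With representatives f a of R/M and an enumeration
--    g b of M, every element is uniquely f a + g b, and it is an exceptional unit
--    iff a is neither the class of 0 nor of 1: m (q - 2) choices.
-- 4. Direct sums.  Units, hence exceptional units, are detected componentwise, and
--    a componentwise predicate is counted by the product of the component counts
--    (mixed-radix digits of Fin (∏ s)).

open import Defs
open import Data.Nat using (ℕ; zero; suc; _*_; _∸_)
open import Data.Fin using (Fin; zero; suc; punchIn; punchOut; remQuot; combine)
open import Data.Fin.Properties
  using (punchIn-injective; punchInᵢ≢i; punchIn-punchOut; remQuot-combine; combine-remQuot)
open import Data.Product using (Σ; ∃; ∃₂; _×_; _,_; proj₁; proj₂; uncurry)
open import Data.Sum using (_⊎_; inj₁; inj₂)
open import Data.Empty using (⊥-elim)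
open import Data.Vec.Functional using (foldr)
open import Function using (_∘_)
open import Function.Bundles using (_⇔_; mk⇔; Equivalence)
open import Relation.Nullary using (¬_)
open import Relation.Binary.PropositionalEquality using (_≡_; _≢_; refl; sym; trans; cong; cong₂; subst)
open import Algebra.Bundles using (CommutativeRing)
import Algebra.Properties.Ring as RingProperties
import Algebra.Properties.AbelianGroup as AbelianGroupProperties
import Algebra.Properties.CommutativeSemigroup as CommutativeSemigroupProperties
import Relation.Binary.Reasoning.Setoid as SetoidReasoning

open Equivalence using (to; from)

module RingTheory (S : Ring₀) where
  open CommutativeRing S hiding (zero; refl; sym; trans) renaming (_*_ to _·_)
  open CommutativeRing S using () renaming (refl to ≈-refl; sym to ≈-sym; trans to ≈-trans)
  open RingProperties ring using (-1*x≈-x)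
  open AbelianGroupProperties +-abelianGroup using (\\-leftDividesʳ; ⁻¹-anti-homo‿-; ε⁻¹≈ε)
  open CommutativeSemigroupProperties +-commutativeSemigroup using (interchange)

  Pred : Set₁
  Pred = Carrier → Set

  _⊆_ : Pred → Pred → Set
  I ⊆ J = ∀ {x} → I x → J x

  _≋_mod_ : Carrier → Carrier → Pred → Set
  x ≋ y mod I = I (x - y)

  module IdealProperties {I : Pred} (idI : IsIdeal S I) where
    open IsIdeal idI public

    neg-closed : ∀ {x} → I x → I (- x)
    neg-closed {x} ix = resp (-1*x≈-x x) (*-closed (- 1#) ix)

    sub-closed : ∀ {x y} → I x → I y → I (x - y)
    sub-closed ix iy = +-closed ix (neg-closed iy)

    ≋-refl : ∀ x → x ≋ x mod I
    ≋-refl x = resp (≈-sym (-‿inverseʳ x)) zero∈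

    ≈⇒≋ : ∀ {x y} → x ≈ y → x ≋ y mod I
    ≈⇒≋ {x} x≈y = resp (+-congˡ (-‿cong x≈y)) (≋-refl x)

    ≋-sym : ∀ {x y} → x ≋ y mod I → y ≋ x mod I
    ≋-sym {x} {y} x≋y = resp (⁻¹-anti-homo‿- x y) (neg-closed x≋y)

    ≋-trans : ∀ {x y z} → x ≋ y mod I → y ≋ z mod I → x ≋ z mod I
    ≋-trans {x} {y} {z} x≋y y≋z = resp telescope (+-closed x≋y y≋z)
      where
      telescope : (x - y) + (y - z) ≈ x - z
      telescope = ≈-trans (+-assoc x (- y) (y - z)) (+-congˡ (\\-leftDividesʳ y (- z)))

    ∈⇒≋0 : ∀ {x} → I x → x ≋ 0# mod I
    ∈⇒≋0 ix = sub-closed ix zero∈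

    ≋0⇒∈ : ∀ {x} → x ≋ 0# mod I → I x
    ≋0⇒∈ {x} x≋0 = resp (≈-trans (+-congˡ ε⁻¹≈ε) (+-identityʳ x)) x≋0

  zeroIdeal : Pred
  zeroIdeal x = x ≈ 0#

  zeroIdeal-isIdeal : IsIdeal S zeroIdeal
  zeroIdeal-isIdeal = record
    { resp = λ x≈y x≈0 → ≈-trans (≈-sym x≈y) x≈0
    ; zero∈ = ≈-refl
    ; +-closed = λ x≈0 y≈0 → ≈-trans (+-cong x≈0 y≈0) (+-identityˡ 0#)
    ; *-closed = λ r x≈0 → ≈-trans (*-congˡ x≈0) (zeroʳ r)
    }

  unit-resp : ∀ {a b} → a ≈ b → IsUnit S b → IsUnit S a
  unit-resp a≈b (v , bv≈1) = v , ≈-trans (*-congʳ a≈b) bv≈1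

  exceptional-resp : ∀ {a b} → a ≈ b → IsExceptionalUnit S b → IsExceptionalUnit S a
  exceptional-resp a≈b (ub , u1-b) = unit-resp a≈b ub , unit-resp (+-congˡ (-‿cong a≈b)) u1-b

  unit∉proper : ∀ {I} → IsIdeal S I → ¬ I 1# → ∀ {y} → IsUnit S y → ¬ I y
  unit∉proper idI 1∉I {y} (v , yv≈1) y∈I =
    1∉I (IsIdeal.resp idI (≈-trans (*-comm v y) yv≈1) (IsIdeal.*-closed idI v y∈I))

  _+⟨_⟩ : Pred → Carrier → Pred
  (I +⟨ e ⟩) z = ∃₂ λ a r → I a × z ≈ a + r · e

  module _ {I : Pred} (idI : IsIdeal S I) (e : Carrier) where
    open IdealProperties idI

    +⟨⟩-isIdeal : IsIdeal S (I +⟨ e ⟩)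
    +⟨⟩-isIdeal = record
      { resp = λ { x≈y (a , r , a∈I , x≈) → a , r , a∈I , ≈-trans (≈-sym x≈y) x≈ }
      ; zero∈ = 0# , 0# , zero∈ , ≈-sym (≈-trans (+-identityˡ _) (zeroˡ e))
      ; +-closed = λ { (a , r , a∈I , x≈) (a′ , r′ , a′∈I , y≈) →
          a + a′ , r + r′ , +-closed a∈I a′∈I , ≈-trans (+-cong x≈ y≈) (collect a r a′ r′) }
      ; *-closed = λ { s (a , r , a∈I , x≈) →
          s · a , s · r , *-closed s a∈I , ≈-trans (*-congˡ x≈) (scale s a r) }
      }
      where
      collect : ∀ a r a′ r′ → (a + r · e) + (a′ + r′ · e) ≈ (a + a′) + (r + r′) · e
      collect a r a′ r′ = ≈-trans (interchange a (r · e) a′ (r′ · e)) (+-congˡ (≈-sym (distribʳ e r r′)))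
      scale : ∀ s a r → s · (a + r · e) ≈ s · a + (s · r) · e
      scale s a r = ≈-trans (distribˡ s a (r · e)) (+-congˡ (≈-sym (*-assoc s r e)))

    ⊆+⟨⟩ : I ⊆ (I +⟨ e ⟩)
    ⊆+⟨⟩ {x} x∈I = x , 0# , x∈I , ≈-sym (≈-trans (+-congˡ (zeroˡ e)) (+-identityʳ x))

    ∈+⟨⟩ : (I +⟨ e ⟩) e
    ∈+⟨⟩ = 0# , 1# , zero∈ , ≈-sym (≈-trans (+-identityˡ _) (*-identityˡ e))

    +⟨⟩-least : ∀ {K} → IsIdeal S K → I ⊆ K → K e → (I +⟨ e ⟩) ⊆ K
    +⟨⟩-least idK I⊆K e∈K (a , r , a∈I , x≈) =
      IsIdeal.resp idK (≈-sym x≈) (IsIdeal.+-closed idK (I⊆K a∈I) (IsIdeal.*-closed idK r e∈K))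

  -- A maximal ideal M decides every proposition Q: the ideal {x | x ∈ M ∨ Q}
  -- contains M, so it is M itself (then ¬ Q, M being proper) or contains 1 (then Q).
  excludedMiddle : ∀ {M} → IsMaximalIdeal S M → (Q : Set) → Q ⊎ ¬ Q
  excludedMiddle {M} maxM Q = decide (maximal M∨Q M∨Q-isIdeal inj₁)
    where
    open IsMaximalIdeal maxM
    open IdealProperties isIdeal using (resp; zero∈; +-closed; *-closed)

    M∨Q : Pred
    M∨Q x = M x ⊎ Q

    add : ∀ {x y} → M∨Q x → M∨Q y → M∨Q (x + y)
    add (inj₁ x∈M) (inj₁ y∈M) = inj₁ (+-closed x∈M y∈M)
    add (inj₁ _) (inj₂ q) = inj₂ q
    add (inj₂ q) _ = inj₂ q

    M∨Q-isIdeal : IsIdeal S M∨Q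
    M∨Q-isIdeal = record
      { resp = λ { x≈y (inj₁ x∈M) → inj₁ (resp x≈y x∈M) ; _ (inj₂ q) → inj₂ q }
      ; zero∈ = inj₁ zero∈
      ; +-closed = add
      ; *-closed = λ { r (inj₁ x∈M) → inj₁ (*-closed r x∈M) ; _ (inj₂ q) → inj₂ q }
      }

    decide : (M∨Q ⊆ M) ⊎ M∨Q 1# → Q ⊎ ¬ Q
    decide (inj₁ M∨Q⊆M) = inj₂ (λ q → proper (M∨Q⊆M (inj₂ q)))
    decide (inj₂ (inj₁ 1∈M)) = ⊥-elim (proper 1∈M)
    decide (inj₂ (inj₂ q)) = inj₁ q

  Saturated : Pred → Carrier → Set₁
  Saturated J e = J e ⊎ (∀ K → IsIdeal S K → J ⊆ K → K e → K 1#)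

  saturated-mono : ∀ {J J′} e → J ⊆ J′ → Saturated J e → Saturated J′ e
  saturated-mono e J⊆J′ (inj₁ e∈J) = inj₁ (J⊆J′ e∈J)
  saturated-mono e J⊆J′ (inj₂ full) = inj₂ (λ K idK J′⊆K → full K idK (J′⊆K ∘ J⊆J′))

  record ProperIdealAbove (I : Pred) : Set₁ where
    field
      ideal   : Pred
      isIdeal : IsIdeal S ideal
      proper  : ¬ ideal 1#
      above   : I ⊆ ideal

  open ProperIdealAbove

  itself : ∀ {I} → IsIdeal S I → ¬ I 1# → ProperIdealAbove I
  itself {I} idI 1∉I = record { ideal = I ; isIdeal = idI ; proper = 1∉I ; above = λ x∈I → x∈I }

  _then_ : ∀ {I} (J : ProperIdealAbove I) → ProperIdealAbove (ideal J) → ProperIdealAbove I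
  J then K = record { ideal = ideal K ; isIdeal = isIdeal K ; proper = proper K ; above = above K ∘ above J }

  -- Classically, a proper ideal grows to a maximal ideal by adding each element of
  -- an enumeration of the ring, whenever this keeps the ideal proper.
  module MaximalExtension (lem : (Q : Set) → Q ⊎ ¬ Q) where

    saturate : ∀ {I} → IsIdeal S I → ¬ I 1# → ∀ e →
               Σ (ProperIdealAbove I) λ J → Saturated (ideal J) e
    saturate {I} idI 1∉I e with lem ((I +⟨ e ⟩) 1#)
    ... | inj₁ 1∈I+e =
      itself idI 1∉I ,
      inj₂ (λ K idK I⊆K e∈K → +⟨⟩-least idI e idK I⊆K e∈K 1∈I+e)
    ... | inj₂ 1∉I+e =
      record { ideal = I +⟨ e ⟩ ; isIdeal = +⟨⟩-isIdeal idI e ; proper = 1∉I+e ; above = ⊆+⟨⟩ idI e } ,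
      inj₁ (∈+⟨⟩ idI e)

    saturateAll : ∀ {k} (E : Fin k → Carrier) {I} → IsIdeal S I → ¬ I 1# →
                  Σ (ProperIdealAbove I) λ J → ∀ j → Saturated (ideal J) (E j)
    saturateAll {zero} E idI 1∉I = itself idI 1∉I , λ ()
    saturateAll {suc k} E idI 1∉I with saturate idI 1∉I (E zero)
    ... | J , J-sat with saturateAll (E ∘ suc) (isIdeal J) (proper J)
    ... | K , K-sat = J then K , K-sat′
      where
      K-sat′ : ∀ j → Saturated (ideal K) (E j)
      K-sat′ zero = saturated-mono (E zero) (above K) J-sat
      K-sat′ (suc j) = K-sat j

    -- A proper ideal saturated at every element is maximal: an ideal K ⊇ J either
    -- adds no element (then K ⊆ J) or adds some x, at which J is saturated, so 1 ∈ K.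
    saturated⇒maximal : ∀ {k} {E : Fin k → Carrier} → (∀ x → ∃ λ j → x ≈ E j) →
                        ∀ {J} → IsIdeal S J → ¬ J 1# → (∀ j → Saturated J (E j)) → IsMaximalIdeal S J
    saturated⇒maximal covers {J} idJ 1∉J J-sat = record { isIdeal = idJ ; proper = 1∉J ; maximal = grow }
      where
      new-element : ∀ K → IsIdeal S K → J ⊆ K → ∀ {x} → K x → ¬ J x → K 1#
      new-element K idK J⊆K {x} x∈K x∉J with covers x
      ... | j , x≈Ej with J-sat j
      ...   | inj₁ Ej∈J = ⊥-elim (x∉J (IsIdeal.resp idJ (≈-sym x≈Ej) Ej∈J))
      ...   | inj₂ full = full K idK J⊆K (IsIdeal.resp idK x≈Ej x∈K)

      grow : ∀ K → IsIdeal S K → J ⊆ K → (K ⊆ J) ⊎ K 1#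
      grow K idK J⊆K with lem (∃ λ x → K x × ¬ J x)
      ... | inj₁ (x , x∈K , x∉J) = inj₂ (new-element K idK J⊆K x∈K x∉J)
      ... | inj₂ nothing-new = inj₁ λ {x} x∈K → decideJ x x∈K (lem (J x))
        where
        decideJ : ∀ x → K x → J x ⊎ ¬ J x → J x
        decideJ x _ (inj₁ x∈J) = x∈J
        decideJ x x∈K (inj₂ x∉J) = ⊥-elim (nothing-new (x , x∈K , x∉J))

    extendToMaximal : ∀ {k} {E : Fin k → Carrier} → (∀ x → ∃ λ j → x ≈ E j) →
                      ∀ {I} → IsIdeal S I → ¬ I 1# → Σ Pred λ B → IsMaximalIdeal S B × I ⊆ B
    extendToMaximal {E = E} covers idI 1∉I with saturateAll E idI 1∉I
    ... | J , J-sat = ideal J , saturated⇒maximal covers (isIdeal J) (proper J) J-sat , above J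

module LocalRing (S : Ring₀) (M : CommutativeRing.Carrier S → Set) (isLocal : IsLocalWithMaximal S M)
    {k : ℕ} (E : Fin k → CommutativeRing.Carrier S)
    (E-covers : ∀ x → ∃ λ j → CommutativeRing._≈_ S x (E j)) where
  open CommutativeRing S hiding (zero) renaming (_*_ to _·_)
  open RingTheory S
  open IsLocalWithMaximal isLocal
  open IsMaximalIdeal isMaximal
  open MaximalExtension (excludedMiddle isMaximal)

  -- A non-unit u generates a proper ideal, which lies in a maximal ideal; by
  -- uniqueness that ideal is contained in M, so u ∈ M.
  nonunit⇒∈M : ∀ {u} → ¬ IsUnit S u → M u
  nonunit⇒∈M {u} u-nonunit = inM (extendToMaximal E-covers (+⟨⟩-isIdeal zeroIdeal-isIdeal u) ⟨u⟩-proper)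
    where
    ⟨u⟩-proper : ¬ (zeroIdeal +⟨ u ⟩) 1#
    ⟨u⟩-proper (a , r , a≈0 , 1≈a+ru) = u-nonunit (r , ur≈1)
      where
      open SetoidReasoning setoid
      ur≈1 : u · r ≈ 1#
      ur≈1 = begin
        u · r      ≈⟨ *-comm u r ⟩
        r · u      ≈⟨ +-identityˡ (r · u) ⟨
        0# + r · u ≈⟨ +-congʳ a≈0 ⟨
        a + r · u  ≈⟨ 1≈a+ru ⟨
        1#         ∎

    inM : (Σ Pred λ B → IsMaximalIdeal S B × (zeroIdeal +⟨ u ⟩) ⊆ B) → M u
    inM (B , B-maximal , ⟨u⟩⊆B) = proj₁ (unique B B-maximal) (⟨u⟩⊆B (∈+⟨⟩ zeroIdeal-isIdeal u))

  ∉M⇒unit : ∀ {y} → ¬ M y → IsUnit S y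
  ∉M⇒unit {y} y∉M with excludedMiddle isMaximal (IsUnit S y)
  ... | inj₁ y-unit = y-unit
  ... | inj₂ y-nonunit = ⊥-elim (y∉M (nonunit⇒∈M y-nonunit))

  exceptional⇔ : ∀ {u} → IsExceptionalUnit S u ⇔ (¬ M u × ¬ M (1# - u))
  exceptional⇔ = mk⇔
    (λ { (u-unit , 1-u-unit) → unit∉proper isIdeal proper u-unit , unit∉proper isIdeal proper 1-u-unit })
    (λ { (u∉M , 1-u∉M) → ∉M⇒unit u∉M , ∉M⇒unit 1-u∉M })

-- remQuot has the left inverse uncurry combine.
remQuot-injective : ∀ {a} b {k k′ : Fin (a * b)} → remQuot {a} b k ≡ remQuot b k′ → k ≡ k′
remQuot-injective {a} b {k} {k′} eq =
  trans (sym (combine-remQuot {a} b k)) (trans (cong (uncurry combine) eq) (combine-remQuot {a} b k′))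

-- Fin q with two distinct points removed is enumerated by Fin (q ∸ 2): first punch
-- out c₁ from Fin q ∖ {c₀} ≅ Fin (q - 1), then c₀ from Fin q.
record AvoidingTwo (q : ℕ) (c₀ c₁ : Fin q) : Set where
  field
    avoid           : Fin (q ∸ 2) → Fin q
    avoid-injective : ∀ i j → avoid i ≡ avoid j → i ≡ j
    avoid-≢c₀       : ∀ i → avoid i ≢ c₀
    avoid-≢c₁       : ∀ i → avoid i ≢ c₁
    avoid-onto      : ∀ a → a ≢ c₀ → a ≢ c₁ → ∃ λ i → avoid i ≡ a

avoidingTwo : ∀ {q} {c₀ c₁ : Fin q} → c₀ ≢ c₁ → AvoidingTwo q c₀ c₁
avoidingTwo {suc zero} {zero} {zero} c₀≢c₁ = ⊥-elim (c₀≢c₁ refl)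
avoidingTwo {suc (suc r)} {c₀} {c₁} c₀≢c₁ = record
  { avoid = avoid
  ; avoid-injective = λ i j eq → punchIn-injective c₁′ i j (punchIn-injective c₀ _ _ eq)
  ; avoid-≢c₀ = λ i → punchInᵢ≢i c₀ _
  ; avoid-≢c₁ = avoid-≢c₁
  ; avoid-onto = avoid-onto
  }
  where
  c₁′ : Fin (suc r)
  c₁′ = punchOut c₀≢c₁

  avoid : Fin r → Fin (suc (suc r))
  avoid i = punchIn c₀ (punchIn c₁′ i)

  avoid-≢c₁ : ∀ i → avoid i ≢ c₁
  avoid-≢c₁ i eq = punchInᵢ≢i c₁′ i (punchIn-injective c₀ _ _ (trans eq (sym (punchIn-punchOut c₀≢c₁))))

  avoid-onto : ∀ a → a ≢ c₀ → a ≢ c₁ → ∃ λ i → avoid i ≡ a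
  avoid-onto a a≢c₀ a≢c₁ = punchOut c₁′≢a′ , trans (cong (punchIn c₀) (punchIn-punchOut c₁′≢a′)) (punchIn-punchOut c₀≢a)
    where
    c₀≢a : c₀ ≢ a
    c₀≢a = a≢c₀ ∘ sym
    a′ : Fin (suc r)
    a′ = punchOut c₀≢a
    c₁′≢a′ : c₁′ ≢ a′
    c₁′≢a′ eq = a≢c₁ (trans (sym (punchIn-punchOut c₀≢a))
                       (trans (cong (punchIn c₀) (sym eq)) (punchIn-punchOut c₀≢c₁)))

module Size {S : Ring₀} {P : CommutativeRing.Carrier S → Set} {k : ℕ} (size : HasSize S P k) where
  open CommutativeRing S using (Carrier; _≈_)

  enum : Fin k → Carrier
  enum = proj₁ size

  enum-injective : ∀ i j → enum i ≈ enum j → i ≡ j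
  enum-injective = proj₁ (proj₂ size)

  enum-∈ : ∀ i → P (enum i)
  enum-∈ = proj₁ (proj₂ (proj₂ size))

  enum-covers : ∀ x → P x → ∃ λ i → x ≈ enum i
  enum-covers = proj₂ (proj₂ (proj₂ size))

module LocalCount (S : Ring₀) (M : CommutativeRing.Carrier S → Set) (isLocal : IsLocalWithMaximal S M)
    (m q : ℕ) (M-size : HasSize S M m) (quotient-size : QuotientHasSize S M q) where
  open CommutativeRing S hiding (zero; refl; sym; trans; _*_)
  open CommutativeRing S using () renaming (sym to ≈-sym; trans to ≈-trans)
  open AbelianGroupProperties +-abelianGroup using (//-rightDividesˡ; //-rightDividesʳ; ∙-cancelˡ)
  open RingTheory S
  open IsLocalWithMaximal isLocal
  open IsMaximalIdeal isMaximal
  open IdealProperties isIdeal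
  open Size {S} M-size renaming (enum to g; enum-injective to g-injective; enum-∈ to g∈M; enum-covers to g-covers)

  f : Fin q → Carrier
  f = proj₁ quotient-size

  f-incongruent : ∀ a c → f a ≋ f c mod M → a ≡ c
  f-incongruent = proj₁ (proj₂ quotient-size)

  f-covers : ∀ x → ∃ λ a → x ≋ f a mod M
  f-covers = proj₂ (proj₂ quotient-size)

  same-class : ∀ {x y a c} → x ≋ f a mod M → y ≋ f c mod M → x ≋ y mod M → a ≡ c
  same-class {a = a} {c} x≋fa y≋fc x≋y = f-incongruent a c (≋-trans (≋-sym x≋fa) (≋-trans x≋y y≋fc))

  class-of-sum : ∀ a b → (f a + g b) ≋ f a mod M
  class-of-sum a b = resp (≈-sym (≈-trans (+-congʳ (+-comm (f a) (g b))) (//-rightDividesʳ (f a) (g b)))) (g∈M b)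

  decompose : ∀ x → ∃₂ λ a b → x ≈ f a + g b
  decompose x with f-covers x
  ... | a , x≋fa with g-covers (x - f a) x≋fa
  ...   | b , x-fa≈gb = a , b , ≈-trans (≈-sym (//-rightDividesˡ (f a) x))
                                   (≈-trans (+-congʳ x-fa≈gb) (+-comm (g b) (f a)))

  decompose-unique : ∀ {a b a′ b′} → f a + g b ≈ f a′ + g b′ → a ≡ a′ × b ≡ b′
  decompose-unique {a} {b} {a′} {b′} eq with same-class (class-of-sum a b) (class-of-sum a′ b′) (≈⇒≋ eq)
  ... | refl = refl , g-injective b b′ (∙-cancelˡ (f a) (g b) (g b′) eq)

  element : Fin (q * m) → Carrier
  element k = f (proj₁ (remQuot {q} m k)) + g (proj₂ (remQuot {q} m k))

  element-covers : ∀ x → ∃ λ k → x ≈ element k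
  element-covers x with decompose x
  ... | a , b , x≈ = combine a b , ≈-trans x≈ (reflexive (cong (λ p → f (proj₁ p) + g (proj₂ p)) (sym (remQuot-combine {q} {m} a b))))

  open LocalRing S M isLocal element element-covers using (exceptional⇔)

  c₀ c₁ : Fin q
  c₀ = proj₁ (f-covers 0#)
  c₁ = proj₁ (f-covers 1#)

  0≋c₀ : 0# ≋ f c₀ mod M
  0≋c₀ = proj₂ (f-covers 0#)

  1≋c₁ : 1# ≋ f c₁ mod M
  1≋c₁ = proj₂ (f-covers 1#)

  c₀≢c₁ : c₀ ≢ c₁
  c₀≢c₁ c₀≡c₁ = proper (≋0⇒∈ (≋-trans 1≋c₁ (≋-sym 0≋c₁)))
    where
    0≋c₁ : 0# ≋ f c₁ mod M
    0≋c₁ = subst (λ c → 0# ≋ f c mod M) c₀≡c₁ 0≋c₀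

  ∈M⇒c₀ : ∀ {a b} → M (f a + g b) → a ≡ c₀
  ∈M⇒c₀ {a} {b} x∈M = same-class (class-of-sum a b) 0≋c₀ (∈⇒≋0 x∈M)

  c₀⇒∈M : ∀ {b} → M (f c₀ + g b)
  c₀⇒∈M {b} = ≋0⇒∈ (≋-trans (class-of-sum c₀ b) (≋-sym 0≋c₀))

  1-∈M⇒c₁ : ∀ {a b} → M (1# - (f a + g b)) → a ≡ c₁
  1-∈M⇒c₁ {a} {b} 1-x∈M = sym (same-class 1≋c₁ (class-of-sum a b) 1-x∈M)

  c₁⇒1-∈M : ∀ {b} → M (1# - (f c₁ + g b))
  c₁⇒1-∈M {b} = ≋-trans 1≋c₁ (≋-sym (class-of-sum c₁ b))

  exceptional⇒avoids : ∀ {a b} → IsExceptionalUnit S (f a + g b) → a ≢ c₀ × a ≢ c₁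
  exceptional⇒avoids exc with to exceptional⇔ exc
  ... | x∉M , 1-x∉M = (λ { refl → x∉M c₀⇒∈M }) , (λ { refl → 1-x∉M c₁⇒1-∈M })

  avoids⇒exceptional : ∀ {a b} → a ≢ c₀ → a ≢ c₁ → IsExceptionalUnit S (f a + g b)
  avoids⇒exceptional a≢c₀ a≢c₁ = from exceptional⇔ (a≢c₀ ∘ ∈M⇒c₀ , a≢c₁ ∘ 1-∈M⇒c₁)

  open AvoidingTwo (avoidingTwo c₀≢c₁)

  exceptional : Fin (m * (q ∸ 2)) → Carrier
  exceptional k = f (avoid (proj₂ (remQuot {m} (q ∸ 2) k))) + g (proj₁ (remQuot {m} (q ∸ 2) k))

  exceptional-injective : ∀ k k′ → exceptional k ≈ exceptional k′ → k ≡ k′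
  exceptional-injective k k′ eq with decompose-unique eq
  ... | a≡a′ , b≡b′ = remQuot-injective {m} (q ∸ 2) (cong₂ _,_ b≡b′ (avoid-injective _ _ a≡a′))

  exceptional-covers : ∀ x → IsExceptionalUnit S x → ∃ λ k → x ≈ exceptional k
  exceptional-covers x x-exc with decompose x
  ... | a , b , x≈ with exceptional⇒avoids (exceptional-resp (≈-sym x≈) x-exc)
  ...   | a≢c₀ , a≢c₁ with avoid-onto a a≢c₀ a≢c₁
  ...     | i , refl = combine b i ,
    ≈-trans x≈ (reflexive (cong (λ p → f (avoid (proj₂ p)) + g (proj₁ p)) (sym (remQuot-combine {m} {q ∸ 2} b i))))

  exceptional-size : HasSize S (IsExceptionalUnit S) (m * (q ∸ 2))
  exceptional-size = exceptional , exceptional-injective ,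
    (λ k → avoids⇒exceptional (avoid-≢c₀ _) (avoid-≢c₁ _)) , exceptional-covers

∏ : ∀ {n} → (Fin n → ℕ) → ℕ
∏ = foldr _*_ 1

-- Fin (∏ s) ≅ (i : Fin n) → Fin (s i): mixed-radix digits and their encoding.
digits : ∀ {n} (s : Fin n → ℕ) → Fin (∏ s) → (i : Fin n) → Fin (s i)
digits {suc n} s k zero = proj₁ (remQuot {s zero} (∏ (s ∘ suc)) k)
digits {suc n} s k (suc i) = digits (s ∘ suc) (proj₂ (remQuot {s zero} (∏ (s ∘ suc)) k)) i

fromDigits : ∀ {n} (s : Fin n → ℕ) → ((i : Fin n) → Fin (s i)) → Fin (∏ s)
fromDigits {zero} s t = zero
fromDigits {suc n} s t = combine (t zero) (fromDigits (s ∘ suc) (t ∘ suc))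

digits-fromDigits : ∀ {n} (s : Fin n → ℕ) t (i : Fin n) → digits s (fromDigits s t) i ≡ t i
digits-fromDigits {suc n} s t zero = cong proj₁ (remQuot-combine {s zero} {∏ (s ∘ suc)} (t zero) (fromDigits (s ∘ suc) (t ∘ suc)))
digits-fromDigits {suc n} s t (suc i) =
  trans (cong (λ k → digits (s ∘ suc) k i) (cong proj₂ (remQuot-combine {s zero} {∏ (s ∘ suc)} (t zero) (fromDigits (s ∘ suc) (t ∘ suc)))))
        (digits-fromDigits (s ∘ suc) (t ∘ suc) i)

digits-injective : ∀ {n} (s : Fin n → ℕ) k k′ → (∀ i → digits s k i ≡ digits s k′ i) → k ≡ k′
digits-injective {zero} s zero zero _ = refl
digits-injective {suc n} s k k′ same =
  remQuot-injective {s zero} (∏ (s ∘ suc)) (cong₂ _,_ (same zero) (digits-injective (s ∘ suc) _ _ (same ∘ suc)))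

module DirectSum (R : Ring₀) (n : ℕ) (Rs : Fin n → Ring₀)
    (φ : CommutativeRing.Carrier R → (i : Fin n) → CommutativeRing.Carrier (Rs i))
    (iso : IsDirectSumIso R n Rs φ) where
  open IsDirectSumIso iso renaming (cong to φ-cong)

  lift : ((i : Fin n) → S.Carrier i) → R.Carrier
  lift t = proj₁ (surjective t)

  φ-lift : ∀ t i → S._≈_ i (φ (lift t) i) (t i)
  φ-lift t = proj₂ (surjective t)

  φ-1- : ∀ x i → S._≈_ i (φ (R.1# R.- x) i) (S._-_ i (S.1# i) (φ x i))
  φ-1- x i = S.trans i (+-hom R.1# (R.- x) i) (S.+-cong i (1-hom i) (-‿hom x i))

  unit-componentwise : ∀ x → IsUnit R x ⇔ (∀ i → IsUnit (Rs i) (φ x i))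
  unit-componentwise x = mk⇔ down up
    where
    down : IsUnit R x → ∀ i → IsUnit (Rs i) (φ x i)
    down (v , xv≈1) i = φ v i , S.trans i (S.sym i (*-hom x v i)) (S.trans i (φ-cong xv≈1 i) (1-hom i))

    up : (∀ i → IsUnit (Rs i) (φ x i)) → IsUnit R x
    up units = v , injective _ _ componentwise
      where
      v : R.Carrier
      v = lift (λ j → proj₁ (units j))
      componentwise : ∀ i → S._≈_ i (φ (x R.* v) i) (φ R.1# i)
      componentwise i = S.trans i (*-hom x v i)
        (S.trans i (S.*-congˡ i (φ-lift _ i)) (S.trans i (proj₂ (units i)) (S.sym i (1-hom i))))

  exceptional-componentwise : ∀ x → IsExceptionalUnit R x ⇔ (∀ i → IsExceptionalUnit (Rs i) (φ x i))
  exceptional-componentwise x = mk⇔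
    (λ { (x-unit , 1-x-unit) i →
      to (unit-componentwise x) x-unit i ,
      RingTheory.unit-resp (Rs i) (S.sym i (φ-1- x i)) (to (unit-componentwise _) 1-x-unit i) })
    (λ exc →
      from (unit-componentwise x) (λ i → proj₁ (exc i)) ,
      from (unit-componentwise _) (λ i → RingTheory.unit-resp (Rs i) (φ-1- x i) (proj₂ (exc i))))

  componentwise-size : {P : R.Carrier → Set} {Ps : (i : Fin n) → S.Carrier i → Set} {s : Fin n → ℕ} →
    (∀ i {a b} → S._≈_ i a b → Ps i b → Ps i a) →
    (∀ x → P x ⇔ (∀ i → Ps i (φ x i))) →
    (∀ i → HasSize (Rs i) (Ps i) (s i)) →
    HasSize R P (∏ s)
  componentwise-size {P} {Ps} {s} Ps-resp P⇔ sizes = element , element-injective , element-∈ , element-covers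
    where
    module Sz (i : Fin n) = Size {Rs i} (sizes i)

    element : Fin (∏ s) → R.Carrier
    element k = lift (λ i → Sz.enum i (digits s k i))

    element-injective : ∀ k k′ → element k R.≈ element k′ → k ≡ k′
    element-injective k k′ eq = digits-injective s k k′ λ i →
      Sz.enum-injective i _ _ (S.trans i (S.sym i (φ-lift _ i)) (S.trans i (φ-cong eq i) (φ-lift _ i)))

    element-∈ : ∀ k → P (element k)
    element-∈ k = from (P⇔ _) (λ i → Ps-resp i (φ-lift _ i) (Sz.enum-∈ i _))

    element-covers : ∀ x → P x → ∃ λ k → x R.≈ element k
    element-covers x x∈P = fromDigits s ds , injective _ _ λ i →
      S.trans i (proj₂ (cover i))
        (S.sym i (S.trans i (φ-lift _ i) (S.reflexive i (cong (Sz.enum i) (digits-fromDigits s ds i)))))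
      where
      cover : ∀ i → ∃ λ c → S._≈_ i (φ x i) (Sz.enum i c)
      cover i = Sz.enum-covers i (φ x i) (to (P⇔ x) x∈P i)
      ds : (i : Fin n) → Fin (s i)
      ds i = proj₁ (cover i)

theorem1p4 : (R : Ring₀) → Finite R →
    (n : ℕ) (Rs : Fin n → Ring₀)
    (φ : CommutativeRing.Carrier R → (i : Fin n) → CommutativeRing.Carrier (Rs i)) →
    IsDirectSumIso R n Rs φ →
    (M : (i : Fin n) → CommutativeRing.Carrier (Rs i) → Set) →
    (∀ i → IsLocalWithMaximal (Rs i) (M i)) →
    (m q : Fin n → ℕ) →
    (∀ i → HasSize (Rs i) (M i) (m i)) →
    (∀ i → QuotientHasSize (Rs i) (M i) (q i)) →
    HasSize R (IsExceptionalUnit R) (foldr (λ a b → a * b) 1 (λ i → m i * (q i ∸ 2)))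
theorem1p4 R _ n Rs φ iso M isLocal m q M-size quotient-size =
  componentwise-size (λ i → RingTheory.exceptional-resp (Rs i)) exceptional-componentwise
    (λ i → LocalCount.exceptional-size (Rs i) (M i) (isLocal i) (m i) (q i) (M-size i) (quotient-size i))
  where open DirectSum R n Rs φ iso
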